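{- Let $T\in[0\mathinner{.\,.}\sigma)^n$. If $T[i\mathinner{.\,.} i+2\ell)$ is a p-square, then $\overrightarrow{T}[i\mathinner{.\,.} i+2\ell)$ and $\overleftarrow{T}[i\mathinner{.\,.} i+2\ell)$ are $\sigma$-mismatch squares.
   Context: $T[i\mathinner{.\,.} j)=T[i]\cdots T[j-1]$; $X^R$ is the reverse of $X$; $\mathrm{alph}(X)$ the set of letters of $X$. Two strings $X,Y$ parameterized match if $|X|=|Y|$ and there is a bijection $f:\mathrm{alph}(X)\to\mathrm{alph}(Y)$ with $f(X[i])=Y[i]$ for all $i$; a p-square is a string $XY$ with $|X|=|Y|$ such that $X$ and $Y$ parameterized match. For a nonempty string $X$, $\mathbf{E}(X)=|\mathrm{alph}(U)|$ where $U$ is the longest suffix of $X[1\mathinner{.\,.}|X|)$ not containing the letter $X[|X|]$. Strings $\overrightarrow{T},\overleftarrow{T}$ of length $n$ are defined by $\overrightarrow{T}[i]=\mathbf{E}(T[1\mathinner{.\,.} i])$ and $\overleftarrow{T}[i]=\mathbf{E}((T[i\mathinner{.\,.} n])^R)$. A $k$-mismatch square is a string $XY$ with $|X|=|Y|$ and $X,Y$ differing in at most $k$ positions. -}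

module Defs where

open import Data.Nat using (ℕ; zero; suc; _+_; _*_; _∸_; _≤_; _<_; _≟_)
open import Data.List using (List; []; _∷_; _++_; length; map; take; drop; reverse; upTo; takeWhile; deduplicate)
open import Data.List.Membership.Propositional using (_∈_)
open import Data.Product using (Σ; ∃; _×_)
open import Relation.Nullary using (¬_; ¬?)
open import Relation.Binary.PropositionalEquality using (_≡_)

-- Strings over ℕ (letters); positions are 0-based.
-- Substring T[i .. j) = T[i] ⋯ T[j-1].
sub : List ℕ → ℕ → ℕ → List ℕ
sub T i j = take (j ∸ i) (drop i T)

alphSize : List ℕ → ℕ
alphSize X = length (deduplicate _≟_ X)

-- E(X) given reverse X = c ∷ rest, where c = X[|X|] and rest = (X[1..|X|))^R.
-- U = longest suffix of X[1..|X|) not containing c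
--   = reverse (takeWhile (≠ c) rest).
-- (Value 0 on the empty string is irrelevant: E is only applied to nonempty strings.)
Erev : List ℕ → ℕ
Erev [] = 0
Erev (c ∷ rest) = alphSize (reverse (takeWhile (λ x → ¬? (x ≟ c)) rest))

E : List ℕ → ℕ
E X = Erev (reverse X)

fwd : List ℕ → List ℕ
fwd T = map (λ j → E (take (suc j) T)) (upTo (length T))

bwd : List ℕ → List ℕ
bwd T = map (λ i → E (reverse (drop i T))) (upTo (length T))

-- parameterized match: equal length and a bijection f : alph(X) → alph(Y)
-- with f(X[i]) = Y[i]; f is given as a function on letters, injective on alph(X);
-- surjectivity onto alph(Y) is implied by map f X ≡ Y.
PMatch : List ℕ → List ℕ → Set
PMatch X Y = length X ≡ length Y ×
  Σ (ℕ → ℕ) (λ f → (∀ a b → a ∈ X → b ∈ X → f a ≡ f b → a ≡ b) × map f X ≡ Y)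

PSquare : List ℕ → Set
PSquare W = Σ (List ℕ) λ X → Σ (List ℕ) λ Y → W ≡ X ++ Y × length X ≡ length Y × PMatch X Y

hamming : List ℕ → List ℕ → ℕ
hamming [] _ = 0
hamming (_ ∷ _) [] = 0
hamming (x ∷ xs) (y ∷ ys) with x ≟ y
... | Relation.Nullary.yes _ = hamming xs ys
... | Relation.Nullary.no _ = suc (hamming xs ys)

MismatchSquare : ℕ → List ℕ → Set
MismatchSquare k W = Σ (List ℕ) λ X → Σ (List ℕ) λ Y →
  W ≡ X ++ Y × length X ≡ length Y × hamming X Y ≤ k

{-# OPTIONS --safe #-}
-- If the letter at a position of X already occurs earlier in X, the value E there only
-- depends on the stretch of X since that occurrence, and a stretch and its renaming under
-- an injective f have the same number of distinct letters.  So the forward encodings of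
-- the two halves X and f(X) of a p-square can only differ at first occurrences of letters
-- of X, and there are at most σ of those; symmetrically, the backward encodings can only
-- differ at last occurrences.
module Submission where

open import Defs
open import Data.Nat using (ℕ; zero; suc; _+_; _*_; _∸_; _≤_; _<_; _≟_; z≤n; s≤s)
open import Data.Nat.Properties using (≤-trans; ≤-refl; ≤-reflexive; n≤1+n; n<1+n; +-monoʳ-≤; +-monoˡ-≤; +-suc; m≤m+n; module ≤-Reasoning)
open import Data.List using (List; []; _∷_; _++_; length; map; take; drop; reverse; upTo; applyUpTo; takeWhile; deduplicate; filter)
open import Data.List.Properties using (++-assoc; ++-identityʳ; unfold-reverse; reverse-involutive; reverse-map; map-upTo; take++drop≡id; length-map; length-upTo; length-filter; filter-accept; filter-reject)
open import Data.List.Membership.Propositional using (_∈_; _∉_)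
open import Data.List.Membership.DecPropositional _≟_ using (_∈?_; _∉?_)
open import Data.List.Membership.Propositional.Properties using (∈-map⁺; ∈-deduplicate⁻; ∈-upTo⁺)
open import Data.List.Relation.Unary.Any.Properties using (reverse⁻)
open import Data.List.Relation.Unary.Any using (here; there)
import Data.List.Relation.Unary.Any as Any
open import Data.List.Relation.Unary.All using (All; []; _∷_)
open import Data.List.Relation.Unary.All.Properties using (take⁺; drop⁺; ++⁻ˡ)
open import Data.List.Relation.Binary.Subset.Propositional using (_⊆_)
open import Data.List.Relation.Binary.Subset.Propositional.Properties using (∈-∷⁺ʳ)
import Data.List.Relation.Binary.Sublist.Propositional as Sublist
import Data.List.Relation.Binary.Sublist.Propositional.Properties as Sublist
open import Data.Product using (_×_; _,_)
open import Function using (_∘_; id; case_of_)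
open import Relation.Binary.Definitions using (DecidableEquality)
open import Relation.Unary using (Decidable; ∁)
open import Relation.Nullary using (¬?; yes; no; contradiction)
open import Relation.Binary.PropositionalEquality using (_≡_; refl; sym; trans; cong; cong₂; subst; module ≡-Reasoning)

InjectiveOn : {A B : Set} → List A → (A → B) → Set
InjectiveOn L f = ∀ a b → a ∈ L → b ∈ L → f a ≡ f b → a ≡ b

module _ {A B : Set} (_≟ᴬ_ : DecidableEquality A) (_≟ᴮ_ : DecidableEquality B)
         {L : List A} {f : A → B} (f-inj : InjectiveOn L f) where

  takeWhile-≢-map : ∀ {x} Q → x ∈ L → Q ⊆ L →
    takeWhile (λ y → ¬? (y ≟ᴮ f x)) (map f Q) ≡ map f (takeWhile (λ y → ¬? (y ≟ᴬ x)) Q)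
  takeWhile-≢-map []      _   _   = refl
  takeWhile-≢-map {x} (q ∷ Q) x∈L Q⊆L with q ≟ᴬ x | f q ≟ᴮ f x
  ... | yes _   | yes _    = refl
  ... | yes q≡x | no fq≢fx = contradiction (cong f q≡x) fq≢fx
  ... | no q≢x  | yes fq≡fx = contradiction (f-inj q x (Q⊆L (here refl)) x∈L fq≡fx) q≢x
  ... | no _    | no _     = cong (f q ∷_) (takeWhile-≢-map Q x∈L (Q⊆L ∘ there))

  filter-≢-map : ∀ {z} D → z ∈ L → D ⊆ L →
    filter (¬? ∘ (f z ≟ᴮ_)) (map f D) ≡ map f (filter (¬? ∘ (z ≟ᴬ_)) D)
  filter-≢-map []      _   _   = refl
  filter-≢-map {z} (d ∷ D) z∈L D⊆L with z ≟ᴬ d | f z ≟ᴮ f d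
  ... | yes _   | yes _     = filter-≢-map D z∈L (D⊆L ∘ there)
  ... | yes z≡d | no fz≢fd  = contradiction (cong f z≡d) fz≢fd
  ... | no z≢d  | yes fz≡fd = contradiction (f-inj z d z∈L (D⊆L (here refl)) fz≡fd) z≢d
  ... | no _    | no _      = cong (f d ∷_) (filter-≢-map D z∈L (D⊆L ∘ there))

  deduplicate-map : ∀ Z → Z ⊆ L → deduplicate _≟ᴮ_ (map f Z) ≡ map f (deduplicate _≟ᴬ_ Z)
  deduplicate-map []      _   = refl
  deduplicate-map (z ∷ Z) Z⊆L = cong (f z ∷_) (begin
    filter (¬? ∘ (f z ≟ᴮ_)) (deduplicate _≟ᴮ_ (map f Z))
      ≡⟨ cong (filter (¬? ∘ (f z ≟ᴮ_))) (deduplicate-map Z (Z⊆L ∘ there)) ⟩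
    filter (¬? ∘ (f z ≟ᴮ_)) (map f (deduplicate _≟ᴬ_ Z))
      ≡⟨ filter-≢-map (deduplicate _≟ᴬ_ Z) (Z⊆L (here refl)) (Z⊆L ∘ there ∘ ∈-deduplicate⁻ _≟ᴬ_ Z) ⟩
    map f (filter (¬? ∘ (z ≟ᴬ_)) (deduplicate _≟ᴬ_ Z)) ∎)
    where open ≡-Reasoning

takeWhile-++ˡ : ∀ {A : Set} {P : A → Set} (P? : Decidable P) {xs} ys →
  Any.Any (∁ P) xs → takeWhile P? (xs ++ ys) ≡ takeWhile P? xs
takeWhile-++ˡ P? {x ∷ xs} ys ∁P∈x∷xs with P? x | ∁P∈x∷xs
... | no _   | _              = refl
... | yes px | here ¬px       = contradiction px ¬px
... | yes _  | there ∁P∈xs    = cong (x ∷_) (takeWhile-++ˡ P? ys ∁P∈xs)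

Erev-++-irrelevant : ∀ {x Q} R → x ∈ Q → Erev (x ∷ Q ++ R) ≡ Erev (x ∷ Q)
Erev-++-irrelevant {x} R x∈Q = cong (alphSize ∘ reverse)
  (takeWhile-++ˡ (λ y → ¬? (y ≟ x)) R (Any.map (λ x≡y y≢x → y≢x (sym x≡y)) x∈Q))

module _ {L : List ℕ} {f : ℕ → ℕ} (f-inj : InjectiveOn L f) where

  alphSize-map : ∀ Z → Z ⊆ L → alphSize (map f Z) ≡ alphSize Z
  alphSize-map Z Z⊆L = trans (cong length (deduplicate-map _≟_ _≟_ f-inj Z Z⊆L))
    (length-map f (deduplicate _≟_ Z))

  Erev-map : ∀ {x} Q → x ∈ L → Q ⊆ L → Erev (f x ∷ map f Q) ≡ Erev (x ∷ Q)
  Erev-map {x} Q x∈L Q⊆L = begin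
    alphSize (reverse (takeWhile (λ y → ¬? (y ≟ f x)) (map f Q)))
      ≡⟨ cong (alphSize ∘ reverse) (takeWhile-≢-map _≟_ _≟_ f-inj Q x∈L Q⊆L) ⟩
    alphSize (reverse (map f U))   ≡⟨ cong alphSize (sym (reverse-map f U)) ⟩
    alphSize (map f (reverse U))   ≡⟨ alphSize-map (reverse U) (Q⊆L ∘ U⊆Q ∘ reverse⁻) ⟩
    alphSize (reverse U)           ∎
    where
    open ≡-Reasoning
    U : List ℕ
    U = takeWhile (λ y → ¬? (y ≟ x)) Q
    U⊆Q : U ⊆ Q
    U⊆Q = Sublist.lookup (Sublist.takeWhile-⊆ (λ y → ¬? (y ≟ x)) Q)

  Erev-repeated-renaming : ∀ {x Q} R₁ R₂ → x ∈ Q → Q ⊆ L →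
    Erev (x ∷ Q ++ R₁) ≡ Erev (f x ∷ map f Q ++ R₂)
  Erev-repeated-renaming {x} {Q} R₁ R₂ x∈Q Q⊆L = begin
    Erev (x ∷ Q ++ R₁)             ≡⟨ Erev-++-irrelevant R₁ x∈Q ⟩
    Erev (x ∷ Q)                   ≡⟨ Erev-map Q (Q⊆L x∈Q) Q⊆L ⟨
    Erev (f x ∷ map f Q)           ≡⟨ Erev-++-irrelevant R₂ (∈-map⁺ f x∈Q) ⟨
    Erev (f x ∷ map f Q ++ R₂)     ∎
    where open ≡-Reasoning

-- The left context R of fwdFrom is kept reversed, as Erev expects.
fwdFrom : List ℕ → List ℕ → List ℕ
fwdFrom R []      = []
fwdFrom R (t ∷ T) = Erev (t ∷ R) ∷ fwdFrom (t ∷ R) T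

bwdBefore : List ℕ → List ℕ → List ℕ
bwdBefore []      R = []
bwdBefore (t ∷ T) R = Erev (t ∷ T ++ R) ∷ bwdBefore T R

reverse-∷-++ : ∀ {A : Set} (t : A) xs R → reverse (t ∷ xs) ++ R ≡ reverse xs ++ t ∷ R
reverse-∷-++ t xs R = trans (cong (_++ R) (unfold-reverse t xs)) (++-assoc (reverse xs) (t ∷ []) R)

applyUpTo-fwdFrom : ∀ T R (g : ℕ → ℕ) → (∀ j → g j ≡ Erev (reverse (take (suc j) T) ++ R)) →
  applyUpTo g (length T) ≡ fwdFrom R T
applyUpTo-fwdFrom []      R g g≗ = refl
applyUpTo-fwdFrom (t ∷ T) R g g≗ = cong₂ _∷_ (g≗ 0) (applyUpTo-fwdFrom T (t ∷ R) (g ∘ suc)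
  (λ j → trans (g≗ (suc j)) (cong Erev (reverse-∷-++ t (take (suc j) T) R))))

applyUpTo-bwdBefore : ∀ T R (g : ℕ → ℕ) → (∀ j → g j ≡ Erev (drop j T ++ R)) →
  applyUpTo g (length T) ≡ bwdBefore T R
applyUpTo-bwdBefore []      R g g≗ = refl
applyUpTo-bwdBefore (t ∷ T) R g g≗ = cong₂ _∷_ (g≗ 0) (applyUpTo-bwdBefore T R (g ∘ suc) (g≗ ∘ suc))

fwd≡fwdFrom : ∀ T → fwd T ≡ fwdFrom [] T
fwd≡fwdFrom T = trans (map-upTo _ (length T)) (applyUpTo-fwdFrom T [] _
  (λ j → cong Erev (sym (++-identityʳ (reverse (take (suc j) T))))))

bwd≡bwdBefore : ∀ T → bwd T ≡ bwdBefore T []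
bwd≡bwdBefore T = trans (map-upTo _ (length T)) (applyUpTo-bwdBefore T [] _
  (λ j → cong Erev (trans (reverse-involutive (drop j T)) (sym (++-identityʳ (drop j T))))))

drop-fwdFrom : ∀ i R T → drop i (fwdFrom R T) ≡ fwdFrom (reverse (take i T) ++ R) (drop i T)
drop-fwdFrom zero    R T       = refl
drop-fwdFrom (suc i) R []      = refl
drop-fwdFrom (suc i) R (t ∷ T) = trans (drop-fwdFrom i (t ∷ R) T)
  (cong (λ R′ → fwdFrom R′ (drop i T)) (sym (reverse-∷-++ t (take i T) R)))

take-fwdFrom : ∀ m R T → take m (fwdFrom R T) ≡ fwdFrom R (take m T)
take-fwdFrom zero    R T       = refl
take-fwdFrom (suc m) R []      = refl
take-fwdFrom (suc m) R (t ∷ T) = cong (Erev (t ∷ R) ∷_) (take-fwdFrom m (t ∷ R) T)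

drop-bwdBefore : ∀ i T R → drop i (bwdBefore T R) ≡ bwdBefore (drop i T) R
drop-bwdBefore zero    T       R = refl
drop-bwdBefore (suc i) []      R = refl
drop-bwdBefore (suc i) (t ∷ T) R = drop-bwdBefore i T R

take-bwdBefore : ∀ m T R → take m (bwdBefore T R) ≡ bwdBefore (take m T) (drop m T ++ R)
take-bwdBefore zero    T       R = refl
take-bwdBefore (suc m) []      R = refl
take-bwdBefore (suc m) (t ∷ T) R = cong₂ _∷_
  (cong (λ T′ → Erev (t ∷ T′)) (trans (cong (_++ R) (sym (take++drop≡id m T)))
                                       (++-assoc (take m T) (drop m T) R)))
  (take-bwdBefore m T R)

sub-fwd : ∀ T i j → sub (fwd T) i j ≡ fwdFrom (reverse (take i T) ++ []) (sub T i j)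
sub-fwd T i j = begin
  take (j ∸ i) (drop i (fwd T))                 ≡⟨ cong (take (j ∸ i) ∘ drop i) (fwd≡fwdFrom T) ⟩
  take (j ∸ i) (drop i (fwdFrom [] T))          ≡⟨ cong (take (j ∸ i)) (drop-fwdFrom i [] T) ⟩
  take (j ∸ i) (fwdFrom R (drop i T))           ≡⟨ take-fwdFrom (j ∸ i) R (drop i T) ⟩
  fwdFrom R (take (j ∸ i) (drop i T))           ∎
  where
  open ≡-Reasoning
  R : List ℕ
  R = reverse (take i T) ++ []

sub-bwd : ∀ T i j → sub (bwd T) i j ≡ bwdBefore (sub T i j) (drop (j ∸ i) (drop i T) ++ [])
sub-bwd T i j = begin
  take (j ∸ i) (drop i (bwd T))                 ≡⟨ cong (take (j ∸ i) ∘ drop i) (bwd≡bwdBefore T) ⟩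
  take (j ∸ i) (drop i (bwdBefore T []))        ≡⟨ cong (take (j ∸ i)) (drop-bwdBefore i T []) ⟩
  take (j ∸ i) (bwdBefore (drop i T) [])        ≡⟨ take-bwdBefore (j ∸ i) (drop i T) [] ⟩
  bwdBefore (take (j ∸ i) (drop i T)) (drop (j ∸ i) (drop i T) ++ []) ∎
  where open ≡-Reasoning

fwdFrom-++ : ∀ R X Y → fwdFrom R (X ++ Y) ≡ fwdFrom R X ++ fwdFrom (reverse X ++ R) Y
fwdFrom-++ R []      Y = refl
fwdFrom-++ R (x ∷ X) Y = cong (Erev (x ∷ R) ∷_) (trans (fwdFrom-++ (x ∷ R) X Y)
  (cong (λ R′ → fwdFrom (x ∷ R) X ++ fwdFrom R′ Y) (sym (reverse-∷-++ x X R))))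

bwdBefore-++ : ∀ X Y R → bwdBefore (X ++ Y) R ≡ bwdBefore X (Y ++ R) ++ bwdBefore Y R
bwdBefore-++ []      Y R = refl
bwdBefore-++ (x ∷ X) Y R = cong₂ _∷_ (cong (λ Z → Erev (x ∷ Z)) (++-assoc X Y R)) (bwdBefore-++ X Y R)

length-fwdFrom : ∀ R X → length (fwdFrom R X) ≡ length X
length-fwdFrom R []      = refl
length-fwdFrom R (x ∷ X) = cong suc (length-fwdFrom (x ∷ R) X)

length-bwdBefore : ∀ X R → length (bwdBefore X R) ≡ length X
length-bwdBefore []      R = refl
length-bwdBefore (x ∷ X) R = cong suc (length-bwdBefore X R)

hamming-∷-≤ : ∀ a b A B → hamming (a ∷ A) (b ∷ B) ≤ suc (hamming A B)
hamming-∷-≤ a b A B with a ≟ b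
... | yes _ = n≤1+n (hamming A B)
... | no _  = ≤-refl

hamming-∷-≡ : ∀ {a b} A B → a ≡ b → hamming (a ∷ A) (b ∷ B) ≡ hamming A B
hamming-∷-≡ {a} A B refl with a ≟ a
... | yes _  = refl
... | no a≢a = contradiction refl a≢a

-- Counting the letters below σ not yet seen, rather than the distinct letters seen so far,
-- makes the pigeonhole bound by σ free.
unseen : List ℕ → List ℕ → ℕ
unseen Q L = length (filter (_∉? Q) L)

unseen-≤ : ∀ σ Q → unseen Q (upTo σ) ≤ σ
unseen-≤ σ Q = ≤-trans (length-filter (_∉? Q) (upTo σ)) (≤-reflexive (length-upTo σ))

unseen-∷-≤ : ∀ x Q L → unseen (x ∷ Q) L ≤ unseen Q L
unseen-∷-≤ x Q L = Sublist.length-mono-≤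
  (Sublist.filter⁺ (_∉? x ∷ Q) (_∉? Q) (λ { refl v∉x∷Q → v∉x∷Q ∘ there }) (Sublist.⊆-refl {x = L}))

unseen-∷ʳ-∈ : ∀ {v Q} L → v ∈ Q → unseen Q (v ∷ L) ≡ unseen Q L
unseen-∷ʳ-∈ {Q = Q} L v∈Q = cong length (filter-reject (_∉? Q) (λ v∉Q → v∉Q v∈Q))

unseen-∷ʳ-∉ : ∀ {v Q} L → v ∉ Q → unseen Q (v ∷ L) ≡ suc (unseen Q L)
unseen-∷ʳ-∉ {Q = Q} L v∉Q = cong length (filter-accept (_∉? Q) v∉Q)

unseen-∷ʳ-≤ : ∀ v Q L → unseen Q (v ∷ L) ≤ suc (unseen Q L)
unseen-∷ʳ-≤ v Q L = case v ∈? Q of λ where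
  (yes v∈Q) → ≤-trans (≤-reflexive (unseen-∷ʳ-∈ L v∈Q)) (n≤1+n (unseen Q L))
  (no v∉Q)  → ≤-reflexive (unseen-∷ʳ-∉ L v∉Q)

unseen-∷-< : ∀ {x Q} L → x ∈ L → x ∉ Q → unseen (x ∷ Q) L < unseen Q L
unseen-∷-< {x} {Q} (x ∷ L) (here refl) x∉Q = begin-strict
  unseen (x ∷ Q) (x ∷ L)  ≡⟨ unseen-∷ʳ-∈ L (here refl) ⟩
  unseen (x ∷ Q) L        ≤⟨ unseen-∷-≤ x Q L ⟩
  unseen Q L              <⟨ n<1+n (unseen Q L) ⟩
  suc (unseen Q L)        ≡⟨ unseen-∷ʳ-∉ L x∉Q ⟨
  unseen Q (x ∷ L)        ∎
  where open ≤-Reasoning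
unseen-∷-< {x} {Q} (v ∷ L) (there x∈L) x∉Q = case v ∈? Q of λ where
    (yes v∈Q) → begin-strict
      unseen (x ∷ Q) (v ∷ L)  ≡⟨ unseen-∷ʳ-∈ L (there v∈Q) ⟩
      unseen (x ∷ Q) L        <⟨ unseen-∷-< L x∈L x∉Q ⟩
      unseen Q L              ≡⟨ unseen-∷ʳ-∈ L v∈Q ⟨
      unseen Q (v ∷ L)        ∎
    (no v∉Q) → begin-strict
      unseen (x ∷ Q) (v ∷ L)  ≤⟨ unseen-∷ʳ-≤ v (x ∷ Q) L ⟩
      suc (unseen (x ∷ Q) L)  <⟨ s≤s (unseen-∷-< L x∈L x∉Q) ⟩
      suc (unseen Q L)        ≡⟨ unseen-∷ʳ-∉ L v∉Q ⟨
      unseen Q (v ∷ L)        ∎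
  where open ≤-Reasoning

data AgreeUnlessFirst (Q : List ℕ) : List ℕ → List ℕ → List ℕ → Set where
  []  : AgreeUnlessFirst Q [] [] []
  _∷_ : ∀ {x xs a A b B} → (x ∈ Q → a ≡ b) → AgreeUnlessFirst (x ∷ Q) xs A B →
        AgreeUnlessFirst Q (x ∷ xs) (a ∷ A) (b ∷ B)

data AgreeUnlessLast : List ℕ → List ℕ → List ℕ → Set where
  []  : AgreeUnlessLast [] [] []
  _∷_ : ∀ {x xs a A b B} → (x ∈ xs → a ≡ b) → AgreeUnlessLast xs A B →
        AgreeUnlessLast (x ∷ xs) (a ∷ A) (b ∷ B)

hamming-≤-unseen : ∀ {σ Q xs A B} → All (_< σ) xs → AgreeUnlessFirst Q xs A B →
  hamming A B ≤ unseen Q (upTo σ)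
hamming-≤-unseen []            []      = z≤n
hamming-≤-unseen {σ} {Q} {x ∷ xs} {a ∷ A} {b ∷ B} (x<σ ∷ xs<σ) (agree ∷ rest) with x ∈? Q
... | yes x∈Q = begin
  hamming (a ∷ A) (b ∷ B)    ≡⟨ hamming-∷-≡ A B (agree x∈Q) ⟩
  hamming A B                ≤⟨ hamming-≤-unseen xs<σ rest ⟩
  unseen (x ∷ Q) (upTo σ)    ≤⟨ unseen-∷-≤ x Q (upTo σ) ⟩
  unseen Q (upTo σ)          ∎
  where open ≤-Reasoning
... | no x∉Q = begin
  hamming (a ∷ A) (b ∷ B)        ≤⟨ hamming-∷-≤ a b A B ⟩
  suc (hamming A B)              ≤⟨ s≤s (hamming-≤-unseen xs<σ rest) ⟩
  suc (unseen (x ∷ Q) (upTo σ))  ≤⟨ unseen-∷-< (upTo σ) (∈-upTo⁺ x<σ) x∉Q ⟩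
  unseen Q (upTo σ)              ∎
  where open ≤-Reasoning

hamming+unseen-≤ : ∀ {σ xs A B} → All (_< σ) xs → AgreeUnlessLast xs A B →
  hamming A B + unseen xs (upTo σ) ≤ σ
hamming+unseen-≤ {σ} []            []      = unseen-≤ σ []
hamming+unseen-≤ {σ} {x ∷ xs} {a ∷ A} {b ∷ B} (x<σ ∷ xs<σ) (agree ∷ rest) with x ∈? xs
... | yes x∈xs = begin
  hamming (a ∷ A) (b ∷ B) + unseen (x ∷ xs) (upTo σ)
    ≡⟨ cong (_+ unseen (x ∷ xs) (upTo σ)) (hamming-∷-≡ A B (agree x∈xs)) ⟩
  hamming A B + unseen (x ∷ xs) (upTo σ)
    ≤⟨ +-monoʳ-≤ (hamming A B) (unseen-∷-≤ x xs (upTo σ)) ⟩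
  hamming A B + unseen xs (upTo σ)
    ≤⟨ hamming+unseen-≤ xs<σ rest ⟩
  σ ∎
  where open ≤-Reasoning
... | no x∉xs = begin
  hamming (a ∷ A) (b ∷ B) + unseen (x ∷ xs) (upTo σ)
    ≤⟨ +-monoˡ-≤ (unseen (x ∷ xs) (upTo σ)) (hamming-∷-≤ a b A B) ⟩
  suc (hamming A B) + unseen (x ∷ xs) (upTo σ)
    ≡⟨ +-suc (hamming A B) (unseen (x ∷ xs) (upTo σ)) ⟨
  hamming A B + suc (unseen (x ∷ xs) (upTo σ))
    ≤⟨ +-monoʳ-≤ (hamming A B) (unseen-∷-< (upTo σ) (∈-upTo⁺ x<σ) x∉xs) ⟩
  hamming A B + unseen xs (upTo σ)
    ≤⟨ hamming+unseen-≤ xs<σ rest ⟩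
  σ ∎
  where open ≤-Reasoning

module _ {L : List ℕ} {f : ℕ → ℕ} (f-inj : InjectiveOn L f) where

  fwdFrom-agreeUnlessFirst : ∀ Q xs R₁ R₂ → Q ⊆ L → xs ⊆ L →
    AgreeUnlessFirst Q xs (fwdFrom (Q ++ R₁) xs) (fwdFrom (map f Q ++ R₂) (map f xs))
  fwdFrom-agreeUnlessFirst Q []       R₁ R₂ Q⊆L xs⊆L = []
  fwdFrom-agreeUnlessFirst Q (x ∷ xs) R₁ R₂ Q⊆L x∷xs⊆L =
    (λ x∈Q → Erev-repeated-renaming f-inj R₁ R₂ x∈Q Q⊆L) ∷
    fwdFrom-agreeUnlessFirst (x ∷ Q) xs R₁ R₂ (∈-∷⁺ʳ (x∷xs⊆L (here refl)) Q⊆L) (x∷xs⊆L ∘ there)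

  bwdBefore-agreeUnlessLast : ∀ xs R₁ R₂ → xs ⊆ L →
    AgreeUnlessLast xs (bwdBefore xs R₁) (bwdBefore (map f xs) R₂)
  bwdBefore-agreeUnlessLast []       R₁ R₂ xs⊆L = []
  bwdBefore-agreeUnlessLast (x ∷ xs) R₁ R₂ x∷xs⊆L =
    (λ x∈xs → Erev-repeated-renaming f-inj R₁ R₂ x∈xs (x∷xs⊆L ∘ there)) ∷
    bwdBefore-agreeUnlessLast xs R₁ R₂ (x∷xs⊆L ∘ there)

module _ {σ : ℕ} {X : List ℕ} (X<σ : All (_< σ) X) {f : ℕ → ℕ} (f-inj : InjectiveOn X f) where

  hamming-fwdFrom-map : ∀ R₁ R₂ → hamming (fwdFrom R₁ X) (fwdFrom R₂ (map f X)) ≤ σ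
  hamming-fwdFrom-map R₁ R₂ = ≤-trans
    (hamming-≤-unseen X<σ (fwdFrom-agreeUnlessFirst f-inj [] X R₁ R₂ (λ ()) id))
    (unseen-≤ σ [])

  hamming-bwdBefore-map : ∀ R₁ R₂ → hamming (bwdBefore X R₁) (bwdBefore (map f X) R₂) ≤ σ
  hamming-bwdBefore-map R₁ R₂ = ≤-trans
    (m≤m+n _ _)
    (hamming+unseen-≤ X<σ (bwdBefore-agreeUnlessLast f-inj X R₁ R₂ id))

fwdFrom-mismatchSquare : ∀ {σ X Y} R → All (_< σ) X → PMatch X Y →
  MismatchSquare σ (fwdFrom R (X ++ Y))
fwdFrom-mismatchSquare {X = X} R X<σ (_ , f , f-inj , refl) =
  fwdFrom R X , fwdFrom (reverse X ++ R) (map f X) , fwdFrom-++ R X (map f X) ,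
  trans (length-fwdFrom R X)
        (sym (trans (length-fwdFrom (reverse X ++ R) (map f X)) (length-map f X))) ,
  hamming-fwdFrom-map X<σ f-inj R (reverse X ++ R)

bwdBefore-mismatchSquare : ∀ {σ X Y} R → All (_< σ) X → PMatch X Y →
  MismatchSquare σ (bwdBefore (X ++ Y) R)
bwdBefore-mismatchSquare {X = X} R X<σ (_ , f , f-inj , refl) =
  bwdBefore X (map f X ++ R) , bwdBefore (map f X) R , bwdBefore-++ X (map f X) R ,
  trans (length-bwdBefore X _) (sym (trans (length-bwdBefore (map f X) R) (length-map f X))) ,
  hamming-bwdBefore-map X<σ f-inj (map f X ++ R) R

lemma20 : (σ n : ℕ) (T : List ℕ) → length T ≡ n → All (_< σ) T →
    (i ℓ : ℕ) → i + 2 * ℓ ≤ n →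
    PSquare (sub T i (i + 2 * ℓ)) →
    MismatchSquare σ (sub (fwd T) i (i + 2 * ℓ)) ×
    MismatchSquare σ (sub (bwd T) i (i + 2 * ℓ))
lemma20 σ n T _ T<σ i ℓ _ (X , Y , T[i,j]≡XY , _ , X≈Y) =
  subst (MismatchSquare σ) (sym (trans (sub-fwd T i j) (cong (fwdFrom left) T[i,j]≡XY)))
    (fwdFrom-mismatchSquare left X<σ X≈Y) ,
  subst (MismatchSquare σ) (sym (trans (sub-bwd T i j) (cong (λ S → bwdBefore S right) T[i,j]≡XY)))
    (bwdBefore-mismatchSquare right X<σ X≈Y)
  where
  j : ℕ
  j = i + 2 * ℓ
  left right : List ℕ
  left  = reverse (take i T) ++ []
  right = drop (j ∸ i) (drop i T) ++ []
  X<σ : All (_< σ) X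
  X<σ = ++⁻ˡ X (subst (All (_< σ)) T[i,j]≡XY (take⁺ (j ∸ i) (drop⁺ i T<σ)))
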